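{- Let $P$ be an aggregate program (over an aggregate signature $\Sigma$, a $\Sigma$-structure $\mathcal D$ and defined predicates $\Pi$) and $\tilde{\mathcal D}$ a three-valued $\Sigma$-structure approximating $\mathcal D$. If an interpretation $I$ is a $\tilde{\mathcal D}$-stable model of $P$, then $I$ is an FLP-stable model of $P$.
   Context: An aggregate signature $\Sigma$ has sorts, sorted function, predicate and aggregate symbols $\mathsf R:\{s_1\times\dots\times s_n\}\times w$; set expressions $\{(x_1,\dots,x_n)\mid\varphi\}$, aggregate atoms $\mathsf R(s,t)$ and aggregate formulas (closed under $\neg,\wedge,\vee,\forall,\exists$) are defined simultaneously; a $\Sigma$-structure interprets aggregate symbols by aggregate relations $R\subseteq\mathcal P(D_1)\times D_2$, set expressions by their set of satisfying tuples, and $\mathsf R(s,t)$ holds iff the pair of values is in the relation. Programs: $\Pi$ is a set of predicate symbols not in $\Sigma$; rules $A\leftarrow\varphi$ with $A$ a $\Pi$-atom and $\varphi$ a $\Sigma(\Pi)$-aggregate formula. Interpretations are subsets $I$ of $base_{\mathcal D}(\Pi)$ (ground $\Pi$-atoms over domain elements); $\mathcal D(I)$ makes exactly the atoms of $I$ true; $inst_{\mathcal D}(P)$ is the set of ground instances of rules; $I$ is a model of a set of ground rules if $\mathcal D(I)\models\varphi$ implies $A\in I$ for every rule $A\leftarrow\varphi$ in it. The reduct $P^I$ is obtained from $inst_{\mathcal D}(P)$ by deleting every rule in whose body some literal or aggregate atom is false in $\mathcal D(I)$; $I$ is an FLP-stable model of $P$ if $I$ is a $\subseteq$-minimal model of $P^I$.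 Three-valued semantics: $\mathbf{THREE}=\{(\mathbf f,\mathbf f),(\mathbf f,\mathbf t),(\mathbf t,\mathbf t)\}$, truth order componentwise (meet $\wedge$, join $\vee$), $\neg(x,y)=(\neg y,\neg x)$, precision order $(x,y)\le_p(x',y')$ iff $x\le x'$, $y'\le y$. Three-valued sets are pairs $(S_1,S_2)$, $S_1\subseteq S_2$, ordered by $(S_1,S_2)\le_p(S_1',S_2')$ iff $S_1\subseteq S_1'$, $S_2'\subseteq S_2$. A three-valued aggregate relation $\mathcal R:\mathcal P(D_1)^c\times D_2\to\mathbf{THREE}$ is $\le_p$-monotone in the set argument and two-valued on exact sets; it approximates $R$ if $\mathcal R((S,S),d)$ is true iff $(S,d)\in R$. $\tilde{\mathcal D}$ approximating $\mathcal D$ agrees with $\mathcal D$ except that each aggregate symbol is interpreted by a three-valued aggregate relation approximating its $\mathcal D$-interpretation. A three-valued interpretation is $(I_1,I_2)$ with $I_1\subseteq I_2$ (atom value $(A\in I_1,A\in I_2)$). Formula values: $\Sigma$-atoms as in $\mathcal D$, $\mathbf{THREE}$-connectives, quantifiers as join/meet over domains, set expressions evaluate to $(S_1,S_2)$ with $S_1$ the tuples where the condition is true and $S_2$ those where it is not false, and $\mathsf R(s,t)$ to $\mathsf R^{\tilde{\mathcal D}}$ of the values. $\Phi_{P,\tilde{\mathcal D}}(I_1,I_2)$ assigns each ground atom the join of values of bodies of ground rules with that head (false if none); write $\Phi^1,\Phi^2$ for its components. $I$ is a $\tilde{\mathcal D}$-stable model of $P$ iff $\Phi_{P,\tilde{\mathcal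 D}}(I,I)=(I,I)$ and $I$ is the least fixpoint of the monotone operator $\Phi^1(\cdot,I)$ on $\{J\mid J\subseteq I\}$. -}

module Defs where

open import Level using (Level; 0ℓ) renaming (suc to lsuc)
open import Data.List using (List; []; _∷_; _++_)
open import Data.List.Membership.Propositional using (_∈_)
open import Data.List.Relation.Unary.All as All using (All; []; _∷_)
open import Data.Product using (Σ; Σ-syntax; ∃; _×_; _,_; proj₁; proj₂)
open import Data.Sum using (_⊎_)
open import Relation.Nullary using (¬_)
open import Relation.Binary.PropositionalEquality using (_≡_)
open import Function.Bundles using (_⇔_)

record Signature : Set₁ where
  field
    Sort : Set
    FunSym  : List Sort → Sort → Set
    PredSym : List Sort → Set
    -- aggregate symbol  R : {s₁ × … × sₙ} × w
    AggSym  : List Sort → Sort → Set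

module _ (Σ' : Signature) where
  open Signature Σ'

  Ctx : Set
  Ctx = List Sort

  -- A set Π of defined predicate symbols (disjoint from Σ by construction)
  DefSyms : Set₁
  DefSyms = List Sort → Set

  module Syntax (Π : DefSyms) where

    mutual
      data Term (Γ : Ctx) : Sort → Set where
        var : ∀ {s} → s ∈ Γ → Term Γ s
        app : ∀ {ss s} → FunSym ss s → Terms Γ ss → Term Γ s

      data Terms (Γ : Ctx) : List Sort → Set where
        []  : Terms Γ []
        _∷_ : ∀ {s ss} → Term Γ s → Terms Γ ss → Terms Γ (s ∷ ss)

    mutual
      data Formula (Γ : Ctx) : Set where
        pred  : ∀ {ss} → PredSym ss → Terms Γ ss → Formula Γ
        defd  : ∀ {ss} → Π ss → Terms Γ ss → Formula Γ
        aggr  : ∀ {ss w} → AggSym ss w → SetExpr Γ ss → Term Γ w → Formula Γ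
        neg   : Formula Γ → Formula Γ
        conj  : Formula Γ → Formula Γ → Formula Γ
        disj  : Formula Γ → Formula Γ → Formula Γ
        all   : (s : Sort) → Formula (s ∷ Γ) → Formula Γ
        ex    : (s : Sort) → Formula (s ∷ Γ) → Formula Γ

      -- set expression {(x₁,…,xₙ) | φ} of sort {s₁ × … × sₙ};
      -- the bound variables x₁…xₙ come first in the context of φ
      data SetExpr (Γ : Ctx) (ss : List Sort) : Set where
        setOf : Formula (ss ++ Γ) → SetExpr Γ ss

    record Rule : Set where
      constructor _⇐_
      field
        {ctx}    : Ctx
        {hsorts} : List Sort
        head : Π hsorts × Terms ctx hsorts
        body : Formula ctx

    record Program : Set₁ where
      field
        Idx  : Set
        rule : Idx → Rule

Tuple : {S : Set} → (S → Set) → List S → Set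
Tuple D ss = All D ss

_⊕_ : {S : Set} {D : S → Set} {xs ys : List S} →
      Tuple D xs → Tuple D ys → Tuple D (xs ++ ys)
[]       ⊕ ys = ys
(x ∷ xs) ⊕ ys = x ∷ (xs ⊕ ys)

_⊆_ : {A : Set} → (A → Set) → (A → Set) → Set
S ⊆ S' = ∀ a → S a → S' a

_≐_ : {A : Set} → (A → Set) → (A → Set) → Set
S ≐ S' = ∀ a → S a ⇔ S' a

record Structure (Σ' : Signature) : Set₁ where
  open Signature Σ'
  field
    Dom    : Sort → Set
    funI   : ∀ {ss s} → FunSym ss s → Tuple Dom ss → Dom s
    predI  : ∀ {ss} → PredSym ss → Tuple Dom ss → Set
    aggI   : ∀ {ss w} → AggSym ss w → (Tuple Dom ss → Set) → Dom w → Set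
    -- R is a relation on *sets*: it does not distinguish equal sets
    aggI-ext : ∀ {ss w} (R : AggSym ss w) {S S' : Tuple Dom ss → Set} (d : Dom w) →
               S ≐ S' → aggI R S d → aggI R S' d

-- a value in THREE is a pair (x , y) : "x = is true", "y = is not false";
-- a three-valued aggregate relation is given by its two components.
record ThreeValuedApprox {Σ' : Signature} (𝒟 : Structure Σ') : Set₁ where
  open Signature Σ'
  open Structure 𝒟
  field
    aggI₁ aggI₂ : ∀ {ss w} → AggSym ss w →
                  (Tuple Dom ss → Set) → (Tuple Dom ss → Set) → Dom w → Set
    agg-ext : ∀ {ss w} (R : AggSym ss w) {S₁ S₂ S₁' S₂' : Tuple Dom ss → Set} (d : Dom w) →
              S₁ ≐ S₁' → S₂ ≐ S₂' →
              (aggI₁ R S₁ S₂ d → aggI₁ R S₁' S₂' d) × (aggI₂ R S₁ S₂ d → aggI₂ R S₁' S₂' d)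
    -- values lie in THREE (on consistent three-valued sets)
    agg-three : ∀ {ss w} (R : AggSym ss w) {S₁ S₂ : Tuple Dom ss → Set} (d : Dom w) →
                S₁ ⊆ S₂ → aggI₁ R S₁ S₂ d → aggI₂ R S₁ S₂ d
    -- ≤ₚ-monotone in the set argument
    agg-mono : ∀ {ss w} (R : AggSym ss w) {S₁ S₂ S₁' S₂' : Tuple Dom ss → Set} (d : Dom w) →
               S₁ ⊆ S₂ → S₁' ⊆ S₂' → S₁ ⊆ S₁' → S₂' ⊆ S₂ →
               (aggI₁ R S₁ S₂ d → aggI₁ R S₁' S₂' d) × (aggI₂ R S₁' S₂' d → aggI₂ R S₁ S₂ d)
    agg-exact : ∀ {ss w} (R : AggSym ss w) (S : Tuple Dom ss → Set) (d : Dom w) →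
                aggI₂ R S S d → aggI₁ R S S d
    agg-approx : ∀ {ss w} (R : AggSym ss w) (S : Tuple Dom ss → Set) (d : Dom w) →
                 aggI₁ R S S d ⇔ aggI R S d

module Semantics {Σ' : Signature} (𝒟 : Structure Σ') (Π : DefSyms Σ') where
  open Signature Σ'
  open Structure 𝒟
  open Syntax Σ' Π

  Env : Ctx Σ' → Set
  Env Γ = Tuple Dom Γ

  mutual
    evalT : ∀ {Γ s} → Term Γ s → Env Γ → Dom s
    evalT (var x)    ρ = All.lookup ρ x
    evalT (app f ts) ρ = funI f (evalTs ts ρ)

    evalTs : ∀ {Γ ss} → Terms Γ ss → Env Γ → Tuple Dom ss
    evalTs []       ρ = []
    evalTs (t ∷ ts) ρ = evalT t ρ ∷ evalTs ts ρ

  GAtom : Set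
  GAtom = Σ[ ss ∈ List Sort ] (Π ss × Tuple Dom ss)

  Interp : Set₁
  Interp = GAtom → Set

  mutual
    ⟦_⟧ : ∀ {Γ} → Formula Γ → Interp → Env Γ → Set
    ⟦ pred p ts ⟧   I ρ = predI p (evalTs ts ρ)
    ⟦ defd {ss} q ts ⟧ I ρ = I (ss , q , evalTs ts ρ)
    ⟦ aggr R s t ⟧  I ρ = aggI R (⟦ s ⟧ˢ I ρ) (evalT t ρ)
    ⟦ neg φ ⟧       I ρ = ¬ ⟦ φ ⟧ I ρ
    ⟦ conj φ ψ ⟧    I ρ = ⟦ φ ⟧ I ρ × ⟦ ψ ⟧ I ρ
    ⟦ disj φ ψ ⟧    I ρ = ⟦ φ ⟧ I ρ ⊎ ⟦ ψ ⟧ I ρ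
    ⟦ all s φ ⟧     I ρ = (d : Dom s) → ⟦ φ ⟧ I (d ∷ ρ)
    ⟦ ex s φ ⟧      I ρ = Σ[ d ∈ Dom s ] ⟦ φ ⟧ I (d ∷ ρ)

    ⟦_⟧ˢ : ∀ {Γ ss} → SetExpr Γ ss → Interp → Env Γ → Tuple Dom ss → Set
    ⟦ setOf φ ⟧ˢ I ρ xs = ⟦ φ ⟧ I (xs ⊕ ρ)

  module _ (P : Program) where
    open Program P

    record GroundRule : Set where
      constructor ground
      field
        idx : Idx
        env : Env (Rule.ctx (rule idx))

    gHead : GroundRule → GAtom
    gHead (ground i ρ) =
      (Rule.hsorts (rule i) , proj₁ (Rule.head (rule i)) , evalTs (proj₂ (Rule.head (rule i))) ρ)

    gBody : GroundRule → Interp → Set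
    gBody (ground i ρ) I = ⟦ Rule.body (rule i) ⟧ I ρ

    GroundProgram : Set₁
    GroundProgram = GroundRule → Set

    IsModel : GroundProgram → Interp → Set
    IsModel G I = ∀ g → G g → gBody g I → I (gHead g)

    reduct : Interp → GroundProgram
    reduct I g = gBody g I

    FLPStable : Interp → Set₁
    FLPStable I = IsModel (reduct I) I ×
                  (∀ (J : Interp) → IsModel (reduct I) J → J ⊆ I → I ⊆ J)

  module ThreeValued (𝒟̃ : ThreeValuedApprox 𝒟) where
    open ThreeValuedApprox 𝒟̃

    THREE : Set₁
    THREE = Set × Set

    mutual
      eval³ : ∀ {Γ} → Formula Γ → Interp → Interp → Env Γ → THREE
      eval³ (pred p ts) I₁ I₂ ρ = predI p (evalTs ts ρ) , predI p (evalTs ts ρ)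
      eval³ (defd {ss} q ts) I₁ I₂ ρ = I₁ (ss , q , evalTs ts ρ) , I₂ (ss , q , evalTs ts ρ)
      eval³ (aggr R s t) I₁ I₂ ρ =
        aggI₁ R (λ xs → proj₁ (evalS³ (s) I₁ I₂ ρ xs)) (λ xs → proj₂ (evalS³ (s) I₁ I₂ ρ xs)) (evalT t ρ) ,
        aggI₂ R (λ xs → proj₁ (evalS³ (s) I₁ I₂ ρ xs)) (λ xs → proj₂ (evalS³ (s) I₁ I₂ ρ xs)) (evalT t ρ)
      eval³ (neg φ)       I₁ I₂ ρ = (¬ proj₂ (eval³ φ I₁ I₂ ρ)) , (¬ proj₁ (eval³ φ I₁ I₂ ρ))
      eval³ (conj φ ψ)    I₁ I₂ ρ = (proj₁ (eval³ φ I₁ I₂ ρ) × proj₁ (eval³ (ψ) I₁ I₂ ρ)) ,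
                                (proj₂ (eval³ (φ) I₁ I₂ ρ) × proj₂ (eval³ (ψ) I₁ I₂ ρ))
      eval³ (disj φ ψ)    I₁ I₂ ρ = (proj₁ (eval³ φ I₁ I₂ ρ) ⊎ proj₁ (eval³ (ψ) I₁ I₂ ρ)) ,
                                (proj₂ (eval³ (φ) I₁ I₂ ρ) ⊎ proj₂ (eval³ (ψ) I₁ I₂ ρ))
      eval³ (all s φ)     I₁ I₂ ρ = ((d : Dom s) → proj₁ (eval³ φ I₁ I₂ (d ∷ ρ))) ,
                                ((d : Dom s) → proj₂ (eval³ (φ) I₁ I₂ (d ∷ ρ)))
      eval³ (ex s φ)      I₁ I₂ ρ = (Σ[ d ∈ Dom s ] proj₁ (eval³ φ I₁ I₂ (d ∷ ρ))) ,
                                (Σ[ d ∈ Dom s ] proj₂ (eval³ (φ) I₁ I₂ (d ∷ ρ)))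

      evalS³ : ∀ {Γ ss} → SetExpr Γ ss → Interp → Interp → Env Γ → Tuple Dom ss → THREE
      evalS³ (setOf φ) I₁ I₂ ρ xs = eval³ (φ) I₁ I₂ (xs ⊕ ρ)

    module _ (P : Program) where
      open Program P

      Φ¹ : Interp → Interp → Interp
      Φ¹ I₁ I₂ A = Σ[ g ∈ GroundRule P ] (gHead P g ≡ A ×
                     proj₁ (eval³ (Rule.body (rule (GroundRule.idx g))) I₁ I₂ (GroundRule.env g)))

      Φ² : Interp → Interp → Interp
      Φ² I₁ I₂ A = Σ[ g ∈ GroundRule P ] (gHead P g ≡ A ×
                     proj₂ (eval³ (Rule.body (rule (GroundRule.idx g))) I₁ I₂ (GroundRule.env g)))

      Stable : Interp → Set₁
      Stable I = (Φ¹ I I ≐ I × Φ² I I ≐ I) ×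
                 -- I is the least fixpoint of Φ¹(·, I) on {J | J ⊆ I}
                 -- (being a fixpoint of Φ¹(·, I) inside {J | J ⊆ I} is already
                 --  given by the first conjunct)
                 (∀ (J : Interp) → J ⊆ I → Φ¹ J I ≐ J → I ⊆ J)

{-# OPTIONS --safe #-}
-- On an exact pair (I, I) both components of the three-valued value of a formula agree with
-- its truth in 𝒟(I), because 𝒟̃ approximates 𝒟 and is two-valued on exact sets. Hence
-- Φ¹(I, I) ⊆ I says that I is a model of the reduct P^I. For minimality, let J ⊆ I be a model
-- of P^I: a body true in (J, I) is, by ≤ₚ-monotonicity, true in both (I, I) and (J, J), so
-- J is a pre-fixpoint of Φ¹(·, I). By the Knaster–Tarski argument the least fixpoint of
-- Φ¹(·, I) below I, which is I itself, is also its least pre-fixpoint, so I ⊆ J.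
module Submission where

open import Defs
open import Level using () renaming (suc to lsuc; zero to lzero)
open import Axiom.ExcludedMiddle using (ExcludedMiddle)
open import Data.Product using (_×_; _,_; proj₁; proj₂)
open import Data.Product.Function.NonDependent.Propositional using (_×-⇔_)
open import Data.Product.Function.Dependent.Propositional using (congˡ)
open import Data.Sum using (inj₁; inj₂)
open import Data.Sum.Function.Propositional using (_⊎-⇔_)
open import Data.List using (_++_)
open import Data.List.Relation.Unary.All using (_∷_)
open import Function.Base using (_∘_; id)
open import Function.Bundles using (_⇔_; mk⇔; module Equivalence)
open import Function.Properties.Equivalence using (sym; trans)
open import Function.Related.Propositional using (equivalence)
open import Function.Related.TypeIsomorphisms using (¬-cong-⇔)
open import Relation.Nullary.Decidable.Core using (True; toWitness; fromWitness)
open import Relation.Binary.PropositionalEquality using (refl; subst)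

open Equivalence using (to; from)

⊆-refl : {A : Set} {S : A → Set} → S ⊆ S
⊆-refl _ x = x

⊆-trans : {A : Set} {S T U : A → Set} → S ⊆ T → T ⊆ U → S ⊆ U
⊆-trans S⊆T T⊆U a = T⊆U a ∘ S⊆T a

≐-sym : {A : Set} {S T : A → Set} → S ≐ T → T ≐ S
≐-sym S≐T a = sym (S≐T a)

Π-cong-⇔ : {A : Set} {B C : A → Set} → (∀ a → B a ⇔ C a) → (∀ a → B a) ⇔ (∀ a → C a)
Π-cong-⇔ B⇔C = mk⇔ (λ f a → to (B⇔C a) (f a)) (λ g a → from (B⇔C a) (g a))

module LeastPreFixpoint (lem : ExcludedMiddle (lsuc lzero)) {A : Set} (U : A → Set)
  (F : (A → Set) → (A → Set))
  (F-mono : ∀ {J J'} → J ⊆ J' → J' ⊆ U → F J ⊆ F J')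
  (F-closed : F U ⊆ U) where

  PreFixpoint : (A → Set) → Set
  PreFixpoint J = J ⊆ U × F J ⊆ J

  -- The intersection quantifies over all predicates, so it lives in Set₁; excluded middle
  -- resizes it to a Set-valued predicate.
  ⋂PreFixpoints : A → Set
  ⋂PreFixpoints a = True (lem {P = ∀ J → PreFixpoint J → J a})

  ⋂PreFixpoints-lowerBound : ∀ J → PreFixpoint J → ⋂PreFixpoints ⊆ J
  ⋂PreFixpoints-lowerBound J pre a k = toWitness k J pre

  ⋂PreFixpoints⊆U : ⋂PreFixpoints ⊆ U
  ⋂PreFixpoints⊆U = ⋂PreFixpoints-lowerBound U (⊆-refl , F-closed)

  ⋂PreFixpoints-preFixpoint : F ⋂PreFixpoints ⊆ ⋂PreFixpoints
  ⋂PreFixpoints-preFixpoint a Fa = fromWitness λ J pre@(J⊆U , FJ⊆J) →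
    FJ⊆J a (F-mono (⋂PreFixpoints-lowerBound J pre) J⊆U a Fa)

  ⋂PreFixpoints-fixpoint : F ⋂PreFixpoints ≐ ⋂PreFixpoints
  ⋂PreFixpoints-fixpoint a = mk⇔ (⋂PreFixpoints-preFixpoint a)
    (⋂PreFixpoints-lowerBound (F ⋂PreFixpoints) F⋂-preFixpoint a)
    where
    F⋂-preFixpoint : PreFixpoint (F ⋂PreFixpoints)
    F⋂-preFixpoint = ⊆-trans (F-mono ⋂PreFixpoints⊆U ⊆-refl) F-closed
                   , F-mono ⋂PreFixpoints-preFixpoint ⋂PreFixpoints⊆U

  leastFixpoint⇒leastPreFixpoint : {L : A → Set} →
    (∀ J → J ⊆ U → F J ≐ J → L ⊆ J) → ∀ J → PreFixpoint J → L ⊆ J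
  leastFixpoint⇒leastPreFixpoint least J pre =
    ⊆-trans (least ⋂PreFixpoints ⋂PreFixpoints⊆U ⋂PreFixpoints-fixpoint)
            (⋂PreFixpoints-lowerBound J pre)

module ThreeValuedSemanticsProperties {Σ' : Signature} (𝒟 : Structure Σ') (Π : DefSyms Σ')
  (𝒟̃ : ThreeValuedApprox 𝒟) where
  open Signature Σ'
  open Structure 𝒟
  open Syntax Σ' Π
  open Semantics 𝒟 Π
  open ThreeValued 𝒟̃
  open ThreeValuedApprox 𝒟̃

  isTrue notFalse : ∀ {Γ} → Formula Γ → Interp → Interp → Env Γ → Set
  isTrue   φ I₁ I₂ ρ = proj₁ (eval³ φ I₁ I₂ ρ)
  notFalse φ I₁ I₂ ρ = proj₂ (eval³ φ I₁ I₂ ρ)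

  module _ {ss w} (R : AggSym ss w) {S₁ S₂ S₁' S₂' : Tuple Dom ss → Set} (d : Dom w)
           (S₁≐S₁' : S₁ ≐ S₁') (S₂≐S₂' : S₂ ≐ S₂') where

    aggI₁-cong : aggI₁ R S₁ S₂ d ⇔ aggI₁ R S₁' S₂' d
    aggI₁-cong = mk⇔ (proj₁ (agg-ext R d S₁≐S₁' S₂≐S₂'))
                     (proj₁ (agg-ext R d (≐-sym S₁≐S₁') (≐-sym S₂≐S₂')))

    aggI₂-cong : aggI₂ R S₁ S₂ d ⇔ aggI₂ R S₁' S₂' d
    aggI₂-cong = mk⇔ (proj₂ (agg-ext R d S₁≐S₁' S₂≐S₂'))
                     (proj₂ (agg-ext R d (≐-sym S₁≐S₁') (≐-sym S₂≐S₂')))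

  aggI₂-exact : ∀ {ss w} (R : AggSym ss w) (S : Tuple Dom ss → Set) (d : Dom w) →
                aggI₂ R S S d ⇔ aggI₁ R S S d
  aggI₂-exact R S d = mk⇔ (agg-exact R S d) (agg-three R d ⊆-refl)

  module _ {I₁ I₂ : Interp} (I₁⊆I₂ : I₁ ⊆ I₂) where
    isTrue⇒notFalse : ∀ {Γ} (φ : Formula Γ) (ρ : Env Γ) →
                      isTrue φ I₁ I₂ ρ → notFalse φ I₁ I₂ ρ
    isTrue⇒notFalse (pred p ts)          ρ t = t
    isTrue⇒notFalse (defd q ts)          ρ t = I₁⊆I₂ _ t
    isTrue⇒notFalse (aggr R (setOf ψ) t) ρ = agg-three R _ (λ xs → isTrue⇒notFalse ψ (xs ⊕ ρ))
    isTrue⇒notFalse (neg φ)              ρ t = t ∘ isTrue⇒notFalse φ ρ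
    isTrue⇒notFalse (conj φ ψ)           ρ (t , u) =
      isTrue⇒notFalse φ ρ t , isTrue⇒notFalse ψ ρ u
    isTrue⇒notFalse (disj φ ψ)           ρ (inj₁ t) = inj₁ (isTrue⇒notFalse φ ρ t)
    isTrue⇒notFalse (disj φ ψ)           ρ (inj₂ u) = inj₂ (isTrue⇒notFalse ψ ρ u)
    isTrue⇒notFalse (all s φ)            ρ t = λ d → isTrue⇒notFalse φ (d ∷ ρ) (t d)
    isTrue⇒notFalse (ex s φ)             ρ (d , t) = d , isTrue⇒notFalse φ (d ∷ ρ) t

  module _ {I₁ I₂ I₁' I₂' : Interp}
           (I₁'⊆I₂' : I₁' ⊆ I₂') (I₁⊆I₁' : I₁ ⊆ I₁') (I₂'⊆I₂ : I₂' ⊆ I₂) where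
    private
      I₁⊆I₂ : I₁ ⊆ I₂
      I₁⊆I₂ = ⊆-trans I₁⊆I₁' (⊆-trans I₁'⊆I₂' I₂'⊆I₂)

    mutual
      isTrue-mono : ∀ {Γ} (φ : Formula Γ) (ρ : Env Γ) →
                    isTrue φ I₁ I₂ ρ → isTrue φ I₁' I₂' ρ
      isTrue-mono (pred p ts)          ρ t = t
      isTrue-mono (defd q ts)          ρ t = I₁⊆I₁' _ t
      isTrue-mono (aggr R (setOf ψ) t) ρ = proj₁ (aggr-mono R ψ t ρ)
      isTrue-mono (neg φ)              ρ t = t ∘ notFalse-antitone φ ρ
      isTrue-mono (conj φ ψ)           ρ (t , u) = isTrue-mono φ ρ t , isTrue-mono ψ ρ u
      isTrue-mono (disj φ ψ)           ρ (inj₁ t) = inj₁ (isTrue-mono φ ρ t)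
      isTrue-mono (disj φ ψ)           ρ (inj₂ u) = inj₂ (isTrue-mono ψ ρ u)
      isTrue-mono (all s φ)            ρ t = λ d → isTrue-mono φ (d ∷ ρ) (t d)
      isTrue-mono (ex s φ)             ρ (d , t) = d , isTrue-mono φ (d ∷ ρ) t

      notFalse-antitone : ∀ {Γ} (φ : Formula Γ) (ρ : Env Γ) →
                          notFalse φ I₁' I₂' ρ → notFalse φ I₁ I₂ ρ
      notFalse-antitone (pred p ts)          ρ t = t
      notFalse-antitone (defd q ts)          ρ t = I₂'⊆I₂ _ t
      notFalse-antitone (aggr R (setOf ψ) t) ρ = proj₂ (aggr-mono R ψ t ρ)
      notFalse-antitone (neg φ)              ρ t = t ∘ isTrue-mono φ ρ
      notFalse-antitone (conj φ ψ)           ρ (t , u) =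
        notFalse-antitone φ ρ t , notFalse-antitone ψ ρ u
      notFalse-antitone (disj φ ψ)           ρ (inj₁ t) = inj₁ (notFalse-antitone φ ρ t)
      notFalse-antitone (disj φ ψ)           ρ (inj₂ u) = inj₂ (notFalse-antitone ψ ρ u)
      notFalse-antitone (all s φ)            ρ t = λ d → notFalse-antitone φ (d ∷ ρ) (t d)
      notFalse-antitone (ex s φ)             ρ (d , t) = d , notFalse-antitone φ (d ∷ ρ) t

      aggr-mono : ∀ {Γ ss w} (R : AggSym ss w) (ψ : Formula (ss ++ Γ)) (t : Term Γ w) (ρ : Env Γ) →
        (isTrue (aggr R (setOf ψ) t) I₁ I₂ ρ → isTrue (aggr R (setOf ψ) t) I₁' I₂' ρ) ×
        (notFalse (aggr R (setOf ψ) t) I₁' I₂' ρ → notFalse (aggr R (setOf ψ) t) I₁ I₂ ρ)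
      aggr-mono R ψ t ρ = agg-mono R (evalT t ρ)
        (λ xs → isTrue⇒notFalse I₁⊆I₂ ψ (xs ⊕ ρ)) (λ xs → isTrue⇒notFalse I₁'⊆I₂' ψ (xs ⊕ ρ))
        (λ xs → isTrue-mono ψ (xs ⊕ ρ)) (λ xs → notFalse-antitone ψ (xs ⊕ ρ))

  module _ (I : Interp) where
    mutual
      isTrue-exact : ∀ {Γ} (φ : Formula Γ) (ρ : Env Γ) → isTrue φ I I ρ ⇔ ⟦ φ ⟧ I ρ
      isTrue-exact (pred p ts)          ρ = mk⇔ id id
      isTrue-exact (defd q ts)          ρ = mk⇔ id id
      isTrue-exact (aggr R (setOf ψ) t) ρ =
        trans (aggI₁-cong R (evalT t ρ) (λ xs → isTrue-exact ψ (xs ⊕ ρ))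
                                        (λ xs → notFalse-exact ψ (xs ⊕ ρ)))
              (agg-approx R _ _)
      isTrue-exact (neg φ)              ρ = ¬-cong-⇔ (notFalse-exact φ ρ)
      isTrue-exact (conj φ ψ)           ρ = isTrue-exact φ ρ ×-⇔ isTrue-exact ψ ρ
      isTrue-exact (disj φ ψ)           ρ = isTrue-exact φ ρ ⊎-⇔ isTrue-exact ψ ρ
      isTrue-exact (all s φ)            ρ = Π-cong-⇔ λ d → isTrue-exact φ (d ∷ ρ)
      isTrue-exact (ex s φ)             ρ = congˡ {k = equivalence} λ {d} → isTrue-exact φ (d ∷ ρ)

      notFalse-exact : ∀ {Γ} (φ : Formula Γ) (ρ : Env Γ) → notFalse φ I I ρ ⇔ ⟦ φ ⟧ I ρ
      notFalse-exact (pred p ts)          ρ = mk⇔ id id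
      notFalse-exact (defd q ts)          ρ = mk⇔ id id
      notFalse-exact (aggr R (setOf ψ) t) ρ =
        trans (aggI₂-cong R (evalT t ρ) (λ xs → isTrue-exact ψ (xs ⊕ ρ))
                                        (λ xs → notFalse-exact ψ (xs ⊕ ρ)))
              (trans (aggI₂-exact R _ _) (agg-approx R _ _))
      notFalse-exact (neg φ)              ρ = ¬-cong-⇔ (isTrue-exact φ ρ)
      notFalse-exact (conj φ ψ)           ρ = notFalse-exact φ ρ ×-⇔ notFalse-exact ψ ρ
      notFalse-exact (disj φ ψ)           ρ = notFalse-exact φ ρ ⊎-⇔ notFalse-exact ψ ρ
      notFalse-exact (all s φ)            ρ = Π-cong-⇔ λ d → notFalse-exact φ (d ∷ ρ)
      notFalse-exact (ex s φ)             ρ = congˡ {k = equivalence} λ {d} → notFalse-exact φ (d ∷ ρ)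

  module _ (P : Program) where
    open Program P

    Φ¹-mono : ∀ {I J J'} → J ⊆ J' → J' ⊆ I → Φ¹ P J I ⊆ Φ¹ P J' I
    Φ¹-mono J⊆J' J'⊆I A (g@(ground i ρ) , head≡A , t) =
      g , head≡A , isTrue-mono J'⊆I J⊆J' ⊆-refl (Rule.body (rule i)) ρ t

    Φ¹-closed⇒reductModel : ∀ {I} → Φ¹ P I I ⊆ I → IsModel P (reduct P I) I
    Φ¹-closed⇒reductModel {I} Φ¹⊆I g@(ground i ρ) _ body =
      Φ¹⊆I _ (g , refl , from (isTrue-exact I (Rule.body (rule i)) ρ) body)

    reductModel⇒Φ¹-preFixpoint : ∀ {I J} → J ⊆ I → IsModel P (reduct P I) J → Φ¹ P J I ⊆ J
    reductModel⇒Φ¹-preFixpoint {I} {J} J⊆I model A (g@(ground i ρ) , head≡A , t) =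
      subst J head≡A (model g (to (isTrue-exact I φ ρ) (isTrue-mono ⊆-refl J⊆I ⊆-refl φ ρ t))
                              (to (isTrue-exact J φ ρ) (isTrue-mono ⊆-refl ⊆-refl J⊆I φ ρ t)))
      where
      φ : Formula (Rule.ctx (rule i))
      φ = Rule.body (rule i)

proposition33 : ExcludedMiddle (lsuc lzero) →
    (Σ' : Signature) (𝒟 : Structure Σ') (Π : DefSyms Σ') (P : Syntax.Program Σ' Π)
    (𝒟̃ : ThreeValuedApprox 𝒟) (I : Semantics.Interp 𝒟 Π) →
    Semantics.ThreeValued.Stable 𝒟 Π 𝒟̃ P I →
    Semantics.FLPStable 𝒟 Π P I
proposition33 lem Σ' 𝒟 Π P 𝒟̃ I ((Φ¹≐I , _) , least) =
  Φ¹-closed⇒reductModel P Φ¹⊆I , minimal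
  where
  open Semantics 𝒟 Π
  open ThreeValued 𝒟̃
  open ThreeValuedSemanticsProperties 𝒟 Π 𝒟̃

  Φ¹⊆I : Φ¹ P I I ⊆ I
  Φ¹⊆I A = to (Φ¹≐I A)

  open LeastPreFixpoint lem I (λ J → Φ¹ P J I) (Φ¹-mono P) Φ¹⊆I

  minimal : ∀ J → IsModel P (reduct P I) J → J ⊆ I → I ⊆ J
  minimal J model J⊆I =
    leastFixpoint⇒leastPreFixpoint least J (J⊆I , reductModel⇒Φ¹-preFixpoint P J⊆I model)
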